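{- Let $n$ be a prime and let $\mathcal{Z}_k = \{X \subseteq \mathbb{Z}_n : |X| = k,\ |X \hat{+} X| = \binom{k}{2}\}$. For each $k = k(n) \in \mathbb{N}$ such that $k = o(n^{1/4})$, we have $$|\mathcal{Z}_k| = \big(1 - o(1)\big)\binom{n}{k}$$ as $n \to \infty$.
   Context: $X \hat{+} X = \{x_1 + x_2 : x_1, x_2 \in X, x_1 \ne x_2\}$. -}

module Defs where

open import Data.Bool using (Bool; true; false; _∧_; not)
open import Data.Nat using (ℕ; zero; suc; _+_; _≡ᵇ_)
open import Data.Nat.DivMod using (_mod_)
open import Data.Fin using (Fin; toℕ)
open import Data.Fin.Subset using (Subset; inside; outside; ∣_∣)
open import Data.Vec using ([]; _∷_; lookup; tabulate)
open import Data.List using (List; []; _∷_; map; _++_; length; filterᵇ; allFin)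
open import Data.Bool.ListAction using (any)
open import Data.Nat.Combinatorics using (_C_)

_+ₙ_ : {n : ℕ} → Fin n → Fin n → Fin n
_+ₙ_ {suc m} x y = (toℕ x + toℕ y) mod suc m

_=ᶠ_ : {n : ℕ} → Fin n → Fin n → Bool
x =ᶠ y = toℕ x ≡ᵇ toℕ y

restrictedSumset : {n : ℕ} → Subset n → Subset n
restrictedSumset {n} X = tabulate λ z →
  any (λ x → any (λ y →
         lookup X x ∧ lookup X y ∧ not (x =ᶠ y) ∧ ((x +ₙ y) =ᶠ z))
       (allFin n))
      (allFin n)

allSubsets : (n : ℕ) → List (Subset n)
allSubsets zero = [] ∷ []
allSubsets (suc n) = map (inside ∷_) (allSubsets n) ++ map (outside ∷_) (allSubsets n)

𝒵 : (n k : ℕ) → List (Subset n)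
𝒵 n k = filterᵇ (λ X → (∣ X ∣ ≡ᵇ k) ∧ (∣ restrictedSumset X ∣ ≡ᵇ (k C 2))) (allSubsets n)

#𝒵 : (n k : ℕ) → ℕ
#𝒵 n k = length (𝒵 n k)

-- A k-subset X of ℤ_n has |X +̂ X| = C(k,2) as soon as X is a weak Sidon set, i.e. contains no
-- additive quadruple: four distinct elements with a + b = c + d; then the C(k,2) pairwise sums
-- are distinct. An additive quadruple is determined by (a, b, c) and lies in C(n − 4, k − 4)
-- of the k-subsets, so at most n³·C(n − 4, k − 4) k-subsets fall outside 𝒵_k. As
-- k(k−1)(k−2)(k−3)·C(n, k) = n(n−1)(n−2)(n−3)·C(n − 4, k − 4), this is at most 8k⁴/n · C(n, k)
-- once n ≥ 6, which is o(C(n, k)) when k⁴ = o(n).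

module Submission where

open import Defs
open import Data.Nat using (ℕ; suc; _*_; _∸_; _^_; _≤_)
open import Data.Nat.Primality using (Prime)
open import Data.Nat.Combinatorics using (_C_)
open import Data.Product using (_×_; ∃-syntax)

open import Data.Bool using (Bool; true; false; T; _∧_; _∨_; not)
open import Data.Bool.ListAction using (any)
open import Data.Bool.Properties using (T-∧; T-≡)
open import Data.Empty using (⊥-elim)
open import Data.Fin using (Fin; zero; suc; toℕ) renaming (_≟_ to _≟ᶠ_)
open import Data.Fin.Properties using (toℕ-fromℕ<; toℕ-injective; toℕ<n)
  renaming (suc-injective to Fin-suc-injective)
open import Data.Fin.Subset using (Subset; inside; outside; ∣_∣; _⊆_)
open import Data.Fin.Subset.Properties using (_⊆?_; p⊆q⇒∣p∣≤∣q∣; ∣p∣≤n)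
open import Data.List using (List; []; _∷_; length; map; _++_; allFin; filterᵇ)
open import Data.List.Properties using (map-tabulate; length-tabulate; length-map; length-++)
open import Data.List.Membership.Propositional using (_∈_; lose)
open import Data.List.Membership.Propositional.Properties
  using (∈-allFin; ∈-filter⁺; ∈-filter⁻; ∈-map⁺; ∈-map⁻; ∈-++⁺ˡ; ∈-++⁺ʳ; ∈-++⁻)
open import Data.List.Relation.Unary.All as All using (All; []; _∷_)
open import Data.List.Relation.Unary.AllPairs using ([]; _∷_)
open import Data.List.Relation.Unary.Any as Any using (here; there)
open import Data.List.Relation.Unary.Any.Properties using (any⁺; any⁻)
open import Data.List.Relation.Unary.Unique.Propositional using (Unique)
import Data.List.Relation.Unary.Unique.Propositional.Properties as Unique
import Data.List.Relation.Unary.Unique.DecPropositional as UniqueDec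
open import Data.Nat using (zero; _+_; _<_; s≤s; z≤n; _%_; _≡ᵇ_; pred; NonZero)
open import Data.Nat.Combinatorics using (nC1≡n; nCk+nC[k+1]≡[n+1]C[k+1])
open import Data.Nat.DivMod using (_mod_; m%n<n; %-distribˡ-+; m%n%n≡m%n; [m+n]%n≡m%n; m<n⇒m%n≡m)
open import Data.Nat.Properties
open import Data.Nat.Solver using (module +-*-Solver)
open import Data.Product using (_,_; ∃₂; proj₂)
open import Data.Sum using (inj₁; inj₂)
open import Data.Vec as Vec using (lookup; []; _∷_)
open import Data.Vec.Properties using (lookup∘tabulate; []=⇒lookup; lookup⇒[]=)
  renaming (tabulate-cong to Vec-tabulate-cong)
open import Function using (_∘_)
open import Function.Bundles using (Equivalence)
open import Relation.Binary.PropositionalEquality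
open import Relation.Nullary using (¬_; contradiction; Dec; does; yes; no; T?; _×-dec_)
open import Algebra.Properties.CommutativeSemigroup +-commutativeSemigroup using (interchange)
open import Algebra.Properties.CommutativeSemigroup *-commutativeSemigroup using (x∙yz≈y∙xz)

-- Addition in ℤ_n

[m%n+o]%n≡[m+o]%n : ∀ m o n .{{_ : NonZero n}} → (m % n + o) % n ≡ (m + o) % n
[m%n+o]%n≡[m+o]%n m o n = begin
  (m % n + o) % n            ≡⟨ %-distribˡ-+ (m % n) o n ⟩
  (m % n % n + o % n) % n    ≡⟨ cong (λ t → (t + o % n) % n) (m%n%n≡m%n m n) ⟩
  (m % n + o % n) % n        ≡⟨ %-distribˡ-+ m o n ⟨
  (m + o) % n                ∎
  where open ≡-Reasoning

+ₙ-comm : ∀ {n} (x y : Fin n) → x +ₙ y ≡ y +ₙ x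
+ₙ-comm {suc n} x y = cong (_mod suc n) (+-comm (toℕ x) (toℕ y))

toℕ-+ₙ : ∀ {n} (x y : Fin (suc n)) → toℕ (x +ₙ y) ≡ (toℕ x + toℕ y) % suc n
toℕ-+ₙ {n} x y = toℕ-fromℕ< (m%n<n (toℕ x + toℕ y) (suc n))

+ₙ-cancelˡ : ∀ {n} (x : Fin n) {y z : Fin n} → x +ₙ y ≡ x +ₙ z → y ≡ z
+ₙ-cancelˡ {suc n} x {y} {z} eq = toℕ-injective (begin
  toℕ y                                   ≡⟨ subtract-x y ⟨
  ((toℕ x + toℕ y) % N + (N ∸ toℕ x)) % N  ≡⟨ cong (λ t → (t + (N ∸ toℕ x)) % N) sums-equal ⟩
  ((toℕ x + toℕ z) % N + (N ∸ toℕ x)) % N  ≡⟨ subtract-x z ⟩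
  toℕ z                                   ∎)
  where
  open ≡-Reasoning
  N = suc n
  sums-equal : (toℕ x + toℕ y) % N ≡ (toℕ x + toℕ z) % N
  sums-equal = trans (sym (toℕ-+ₙ x y)) (trans (cong toℕ eq) (toℕ-+ₙ x z))
  subtract-x : ∀ w → ((toℕ x + toℕ w) % N + (N ∸ toℕ x)) % N ≡ toℕ w
  subtract-x w = begin
    ((toℕ x + toℕ w) % N + (N ∸ toℕ x)) % N  ≡⟨ [m%n+o]%n≡[m+o]%n (toℕ x + toℕ w) (N ∸ toℕ x) N ⟩
    (toℕ x + toℕ w + (N ∸ toℕ x)) % N        ≡⟨ cong (_% N) (+-comm (toℕ x + toℕ w) (N ∸ toℕ x)) ⟩
    ((N ∸ toℕ x) + (toℕ x + toℕ w)) % N      ≡⟨ cong (_% N) (+-assoc (N ∸ toℕ x) (toℕ x) (toℕ w)) ⟨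
    ((N ∸ toℕ x) + toℕ x + toℕ w) % N        ≡⟨ cong (λ t → (t + toℕ w) % N) (m∸n+n≡m (<⇒≤ (toℕ<n x))) ⟩
    (N + toℕ w) % N                          ≡⟨ cong (_% N) (+-comm N (toℕ w)) ⟩
    (toℕ w + N) % N                          ≡⟨ [m+n]%n≡m%n (toℕ w) N ⟩
    toℕ w % N                                ≡⟨ m<n⇒m%n≡m (toℕ<n w) ⟩
    toℕ w                                    ∎

+ₙ-cancelʳ : ∀ {n} (x : Fin n) {y z : Fin n} → y +ₙ x ≡ z +ₙ x → y ≡ z
+ₙ-cancelʳ x {y} {z} eq = +ₙ-cancelˡ x (trans (+ₙ-comm x y) (trans eq (+ₙ-comm z x)))

=ᶠ⇒≡ : ∀ {n} {x y : Fin n} → T (x =ᶠ y) → x ≡ y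
=ᶠ⇒≡ {x = x} {y} eq = toℕ-injective (≡ᵇ⇒≡ (toℕ x) (toℕ y) eq)

≡⇒=ᶠ : ∀ {n} {x y : Fin n} → x ≡ y → T (x =ᶠ y)
≡⇒=ᶠ {x = x} refl = ≡⇒≡ᵇ (toℕ x) (toℕ x) refl

T-ext : ∀ {a b} → (T a → T b) → (T b → T a) → a ≡ b
T-ext {true}  {true}  _ _ = refl
T-ext {true}  {false} f _ = ⊥-elim (f _)
T-ext {false} {true}  _ g = ⊥-elim (g _)
T-ext {false} {false} _ _ = refl

T-not⇒¬T : ∀ {b} → T (not b) → ¬ T b
T-not⇒¬T {true} ()

¬T⇒T-not : ∀ {b} → ¬ T b → T (not b)
¬T⇒T-not {true}  ¬b = ¬b _
¬T⇒T-not {false} _  = _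

any-allFin⁻ : ∀ {n} (p : Fin n → Bool) → T (any p (allFin n)) → ∃[ i ] T (p i)
any-allFin⁻ {n} p h = Any.satisfied (any⁻ p (allFin n) h)

any-allFin⁺ : ∀ {n} (p : Fin n → Bool) i → T (p i) → T (any p (allFin n))
any-allFin⁺ p i h = any⁺ p (lose (∈-allFin i) h)

⟦_⟧ : Bool → ℕ
⟦ true  ⟧ = 1
⟦ false ⟧ = 0

⟦⟧≡0 : ∀ {b} → ¬ T b → ⟦ b ⟧ ≡ 0
⟦⟧≡0 {true}  ¬b = contradiction _ ¬b
⟦⟧≡0 {false} _  = refl

⟦⟧≤1 : ∀ b → ⟦ b ⟧ ≤ 1
⟦⟧≤1 true  = ≤-refl
⟦⟧≤1 false = z≤n

⟦∨⟧ : ∀ a b → ¬ (T a × T b) → ⟦ a ∨ b ⟧ ≡ ⟦ a ⟧ + ⟦ b ⟧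
⟦∨⟧ true  true  ¬ab = contradiction (_ , _) ¬ab
⟦∨⟧ true  false _   = refl
⟦∨⟧ false b     _   = refl

⟦⟧-split : ∀ a b → ⟦ a ⟧ ≡ ⟦ a ∧ b ⟧ + ⟦ a ∧ not b ⟧
⟦⟧-split true  true  = refl
⟦⟧-split true  false = refl
⟦⟧-split false _     = refl

⟦does⟧≡1 : ∀ {p} {P : Set p} (p? : Dec P) → P → ⟦ does p? ⟧ ≡ 1
⟦does⟧≡1 (yes _) _  = refl
⟦does⟧≡1 (no ¬p) p  = contradiction p ¬p

T-does⇒ : ∀ {p} {P : Set p} (p? : Dec P) → T (does p?) → P
T-does⇒ (yes p) _ = p

⟦does⟧*-mono-≤ : ∀ {p} {P : Set p} (p? : Dec P) {x y} → (P → x ≤ y) → ⟦ does p? ⟧ * x ≤ ⟦ does p? ⟧ * y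
⟦does⟧*-mono-≤ (yes p) x≤y = +-monoˡ-≤ 0 (x≤y p)
⟦does⟧*-mono-≤ (no _)  _   = z≤n

-- Finite sums

∑ : ∀ {a} {A : Set a} → List A → (A → ℕ) → ℕ
∑ []       f = 0
∑ (x ∷ xs) f = f x + ∑ xs f

infix 5 ∑ ∑<
syntax ∑ xs (λ x → e) = ∑[ x ∈ xs ] e

∑< : (n : ℕ) → (Fin n → ℕ) → ℕ
∑< n = ∑ (allFin n)

syntax ∑< n (λ i → e) = ∑[ i < n ] e

module _ {a} {A : Set a} where

  ∑-const : ∀ (xs : List A) c → ∑[ x ∈ xs ] c ≡ length xs * c
  ∑-const []       c = refl
  ∑-const (x ∷ xs) c = cong (c +_) (∑-const xs c)

  ∑-0 : ∀ (xs : List A) → ∑[ x ∈ xs ] 0 ≡ 0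
  ∑-0 xs = trans (∑-const xs 0) (*-zeroʳ (length xs))

  ∑-cong : ∀ (xs : List A) {f g : A → ℕ} → (∀ x → f x ≡ g x) → ∑ xs f ≡ ∑ xs g
  ∑-cong []       _  = refl
  ∑-cong (x ∷ xs) eq = cong₂ _+_ (eq x) (∑-cong xs eq)

  ∑-mono-≤ : ∀ (xs : List A) {f g : A → ℕ} → (∀ x → f x ≤ g x) → ∑ xs f ≤ ∑ xs g
  ∑-mono-≤ []       _  = z≤n
  ∑-mono-≤ (x ∷ xs) le = +-mono-≤ (le x) (∑-mono-≤ xs le)

  ∑-distrib-+ : ∀ (xs : List A) (f g : A → ℕ) → ∑[ x ∈ xs ] (f x + g x) ≡ ∑ xs f + ∑ xs g
  ∑-distrib-+ []       f g = refl
  ∑-distrib-+ (x ∷ xs) f g =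
    trans (cong (f x + g x +_) (∑-distrib-+ xs f g)) (interchange (f x) (g x) (∑ xs f) (∑ xs g))

  ∑-*ˡ : ∀ (xs : List A) c (f : A → ℕ) → ∑[ x ∈ xs ] (c * f x) ≡ c * ∑ xs f
  ∑-*ˡ []       c f = sym (*-zeroʳ c)
  ∑-*ˡ (x ∷ xs) c f = trans (cong (c * f x +_) (∑-*ˡ xs c f)) (sym (*-distribˡ-+ c (f x) _))

  ∑-*ʳ : ∀ (xs : List A) c (f : A → ℕ) → ∑[ x ∈ xs ] (f x * c) ≡ ∑ xs f * c
  ∑-*ʳ xs c f = trans (∑-cong xs (λ x → *-comm (f x) c)) (trans (∑-*ˡ xs c f) (*-comm c (∑ xs f)))

  ∑-++ : ∀ (xs ys : List A) (f : A → ℕ) → ∑ (xs ++ ys) f ≡ ∑ xs f + ∑ ys f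
  ∑-++ []       ys f = refl
  ∑-++ (x ∷ xs) ys f = trans (cong (f x +_) (∑-++ xs ys f)) (sym (+-assoc (f x) _ _))

  ∑-map : ∀ {b} {B : Set b} (g : B → A) (ys : List B) (f : A → ℕ) → ∑ (map g ys) f ≡ ∑[ y ∈ ys ] f (g y)
  ∑-map g []       f = refl
  ∑-map g (y ∷ ys) f = cong (f (g y) +_) (∑-map g ys f)

  ∈⇒≤∑ : ∀ {xs : List A} {x} (f : A → ℕ) → x ∈ xs → f x ≤ ∑ xs f
  ∈⇒≤∑ f (here refl) = m≤m+n _ _
  ∈⇒≤∑ {y ∷ _} f (there x∈xs) = ≤-trans (∈⇒≤∑ f x∈xs) (m≤n+m _ (f y))

  length-filterᵇ : ∀ (p : A → Bool) xs → length (filterᵇ p xs) ≡ ∑[ x ∈ xs ] ⟦ p x ⟧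
  length-filterᵇ p []       = refl
  length-filterᵇ p (x ∷ xs) with p x
  ... | true  = cong suc (length-filterᵇ p xs)
  ... | false = length-filterᵇ p xs

∑-comm : ∀ {a b} {A : Set a} {B : Set b} (xs : List A) (ys : List B) (f : A → B → ℕ) →
         ∑[ x ∈ xs ] ∑[ y ∈ ys ] f x y ≡ ∑[ y ∈ ys ] ∑[ x ∈ xs ] f x y
∑-comm []       ys f = sym (∑-0 ys)
∑-comm (x ∷ xs) ys f =
  trans (cong (∑ ys (f x) +_) (∑-comm xs ys f)) (sym (∑-distrib-+ ys (f x) _))

∑<-suc : ∀ n (f : Fin (suc n) → ℕ) → ∑[ i < suc n ] f i ≡ f zero + (∑[ i < n ] f (suc i))
∑<-suc n f = cong (f zero +_)
  (trans (cong (λ xs → ∑ xs f) (sym (map-tabulate (λ i → i) suc))) (∑-map suc (allFin n) f))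

∑<-const : ∀ n c → ∑[ i < n ] c ≡ n * c
∑<-const n c = trans (∑-const (allFin n) c) (cong (_* c) (length-tabulate {n = n} (λ i → i)))

∣p∣≡∑⟦p⟧ : ∀ {n} (p : Subset n) → ∣ p ∣ ≡ ∑[ i < n ] ⟦ lookup p i ⟧
∣p∣≡∑⟦p⟧ {zero}  []      = refl
∣p∣≡∑⟦p⟧ {suc n} (true  ∷ p) = trans (cong suc (∣p∣≡∑⟦p⟧ p)) (sym (∑<-suc n (⟦_⟧ ∘ lookup (true ∷ p))))
∣p∣≡∑⟦p⟧ {suc n} (false ∷ p) = trans (∣p∣≡∑⟦p⟧ p) (sym (∑<-suc n (⟦_⟧ ∘ lookup (false ∷ p))))

∑⟦=ᶠ⟧≡1 : ∀ {n} (x : Fin n) → ∑[ z < n ] ⟦ x =ᶠ z ⟧ ≡ 1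
∑⟦=ᶠ⟧≡1 {suc n} zero    = trans (∑<-suc n (λ z → ⟦ zero =ᶠ z ⟧)) (cong suc (∑-0 (allFin n)))
∑⟦=ᶠ⟧≡1 {suc n} (suc x) = trans (∑<-suc n (λ z → ⟦ suc x =ᶠ z ⟧)) (∑⟦=ᶠ⟧≡1 x)

∑⟦⟧≤1 : ∀ {n} (p : Fin n → Bool) → (∀ {i j} → T (p i) → T (p j) → i ≡ j) → ∑[ i < n ] ⟦ p i ⟧ ≤ 1
∑⟦⟧≤1 {zero}  p _      = z≤n
∑⟦⟧≤1 {suc n} p unique rewrite ∑<-suc n (⟦_⟧ ∘ p) with p zero in p0
... | false = ∑⟦⟧≤1 (p ∘ suc) (λ pi pj → Fin-suc-injective (unique pi pj))
... | true  = ≤-reflexive (cong suc (trans (∑-cong (allFin n) rest-absent) (∑-0 (allFin n))))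
  where
  rest-absent : ∀ i → ⟦ p (suc i) ⟧ ≡ 0
  rest-absent i = ⟦⟧≡0 (λ pi → 0≢1+n (cong toℕ (unique (subst T (sym p0) _) pi)))

∑⁴ : (n : ℕ) → (Fin n → Fin n → Fin n → Fin n → ℕ) → ℕ
∑⁴ n f = ∑[ a < n ] ∑[ b < n ] ∑[ c < n ] ∑[ d < n ] f a b c d

∑⁴-cong : ∀ n {f g : Fin n → Fin n → Fin n → Fin n → ℕ} →
          (∀ a b c d → f a b c d ≡ g a b c d) → ∑⁴ n f ≡ ∑⁴ n g
∑⁴-cong n f≡g =
  ∑-cong (allFin n) λ a → ∑-cong (allFin n) λ b →
  ∑-cong (allFin n) λ c → ∑-cong (allFin n) λ d → f≡g a b c d

∑⁴-mono-≤ : ∀ n {f g : Fin n → Fin n → Fin n → Fin n → ℕ} →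
            (∀ a b c d → f a b c d ≤ g a b c d) → ∑⁴ n f ≤ ∑⁴ n g
∑⁴-mono-≤ n f≤g =
  ∑-mono-≤ (allFin n) λ a → ∑-mono-≤ (allFin n) λ b →
  ∑-mono-≤ (allFin n) λ c → ∑-mono-≤ (allFin n) λ d → f≤g a b c d

∑⁴-*ˡ : ∀ n x (f : Fin n → Fin n → Fin n → Fin n → ℕ) → ∑⁴ n (λ a b c d → x * f a b c d) ≡ x * ∑⁴ n f
∑⁴-*ˡ n x f =
  trans (∑-cong (allFin n) λ a → trans (∑-cong (allFin n) λ b → trans (∑-cong (allFin n) λ c →
    ∑-*ˡ (allFin n) x (f a b c)) (∑-*ˡ (allFin n) x _)) (∑-*ˡ (allFin n) x _)) (∑-*ˡ (allFin n) x _)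

∑-∑⁴-comm : ∀ {a} {A : Set a} (xs : List A) n (f : A → Fin n → Fin n → Fin n → Fin n → ℕ) →
            ∑[ x ∈ xs ] ∑⁴ n (f x) ≡ ∑⁴ n (λ a b c d → ∑[ x ∈ xs ] f x a b c d)
∑-∑⁴-comm xs n f =
  trans (∑-comm xs (allFin n) _) (∑-cong (allFin n) λ a →
  trans (∑-comm xs (allFin n) _) (∑-cong (allFin n) λ b →
  trans (∑-comm xs (allFin n) _) (∑-cong (allFin n) λ c → ∑-comm xs (allFin n) _)))

≤∑⁴ : ∀ n (f : Fin n → Fin n → Fin n → Fin n → ℕ) a b c d → f a b c d ≤ ∑⁴ n f
≤∑⁴ n f a b c d =
  ≤-trans (∈⇒≤∑ (f a b c) (∈-allFin d)) (≤-trans (∈⇒≤∑ (λ c → ∑ (allFin n) (f a b c)) (∈-allFin c))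
    (≤-trans (∈⇒≤∑ (λ b → ∑⁴-inner a b) (∈-allFin b)) (∈⇒≤∑ (λ a → ∑[ b < n ] ∑⁴-inner a b) (∈-allFin a))))
  where
  ∑⁴-inner : Fin n → Fin n → ℕ
  ∑⁴-inner a b = ∑[ c < n ] ∑[ d < n ] f a b c d

-- Subsets given by lists; restricted sumsets of weak Sidon sets

toSubset : ∀ {n} → List (Fin n) → Subset n
toSubset xs = Vec.tabulate (λ z → any (_=ᶠ z) xs)

any-=ᶠ⁻ : ∀ {n} {z : Fin n} xs → T (any (_=ᶠ z) xs) → z ∈ xs
any-=ᶠ⁻ xs h = Any.map (sym ∘ =ᶠ⇒≡) (any⁻ _ xs h)

any-=ᶠ⁺ : ∀ {n} {z : Fin n} {xs} → z ∈ xs → T (any (_=ᶠ z) xs)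
any-=ᶠ⁺ z∈xs = any⁺ _ (Any.map (≡⇒=ᶠ ∘ sym) z∈xs)

toSubset⊆ : ∀ {n} {xs : List (Fin n)} {X : Subset n} → (∀ {x} → x ∈ xs → T (lookup X x)) → toSubset xs ⊆ X
toSubset⊆ {xs = xs} {X} xs⊆X {x} x∈S = lookup⇒[]= x X (Equivalence.to T-≡ (xs⊆X (any-=ᶠ⁻ xs x∈xs)))
  where
  x∈xs : T (any (_=ᶠ x) xs)
  x∈xs = Equivalence.from T-≡ (trans (sym (lookup∘tabulate _ x)) ([]=⇒lookup x∈S))

∣toSubset∣≡length : ∀ {n} {xs : List (Fin n)} → Unique xs → ∣ toSubset xs ∣ ≡ length xs
∣toSubset∣≡length {n} {xs} unique = begin
  ∣ toSubset xs ∣                        ≡⟨ ∣p∣≡∑⟦p⟧ (toSubset xs) ⟩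
  ∑[ z < n ] ⟦ lookup (toSubset xs) z ⟧  ≡⟨ ∑-cong (allFin n) (cong ⟦_⟧ ∘ lookup∘tabulate _) ⟩
  ∑[ z < n ] ⟦ any (_=ᶠ z) xs ⟧           ≡⟨ count unique ⟩
  length xs                              ∎
  where
  open ≡-Reasoning
  count : ∀ {xs} → Unique xs → ∑[ z < n ] ⟦ any (_=ᶠ z) xs ⟧ ≡ length xs
  count {[]}     []             = ∑-0 (allFin n)
  count {x ∷ xs} (x∉xs ∷ unique) = begin
    ∑[ z < n ] ⟦ (x =ᶠ z) ∨ any (_=ᶠ z) xs ⟧               ≡⟨ ∑-cong (allFin n) (λ z → ⟦∨⟧ _ _ (disjoint z)) ⟩
    ∑[ z < n ] (⟦ x =ᶠ z ⟧ + ⟦ any (_=ᶠ z) xs ⟧)           ≡⟨ ∑-distrib-+ (allFin n) _ _ ⟩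
    (∑[ z < n ] ⟦ x =ᶠ z ⟧) + (∑[ z < n ] ⟦ any (_=ᶠ z) xs ⟧) ≡⟨ cong₂ _+_ (∑⟦=ᶠ⟧≡1 x) (count unique) ⟩
    suc (length xs)                                       ∎
    where
    disjoint : ∀ z → ¬ (T (x =ᶠ z) × T (any (_=ᶠ z) xs))
    disjoint z (x=z , z∈xs) = All.lookup x∉xs (any-=ᶠ⁻ xs z∈xs) (=ᶠ⇒≡ x=z)

elements : ∀ {n} → Subset n → List (Fin n)
elements {n} p = filterᵇ (lookup p) (allFin n)

elements-unique : ∀ {n} (p : Subset n) → Unique (elements p)
elements-unique {n} p = Unique.filter⁺ (T? ∘ lookup p) (Unique.allFin⁺ n)

∈-elements⁺ : ∀ {n} (p : Subset n) {i} → T (lookup p i) → i ∈ elements p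
∈-elements⁺ p {i} = ∈-filter⁺ (T? ∘ lookup p) (∈-allFin i)

∈-elements⁻ : ∀ {n} (p : Subset n) {i} → i ∈ elements p → T (lookup p i)
∈-elements⁻ {n} p = proj₂ ∘ ∈-filter⁻ (T? ∘ lookup p) {xs = allFin n}

length-elements : ∀ {n} (p : Subset n) → length (elements p) ≡ ∣ p ∣
length-elements {n} p = trans (length-filterᵇ (lookup p) (allFin n)) (sym (∣p∣≡∑⟦p⟧ p))

pairSums : ∀ {n} → List (Fin n) → List (Fin n)
pairSums []       = []
pairSums (x ∷ xs) = map (x +ₙ_) xs ++ pairSums xs

length-pairSums : ∀ {n} (xs : List (Fin n)) → length (pairSums xs) ≡ length xs C 2
length-pairSums []       = refl
length-pairSums (x ∷ xs) = begin
  length (map (x +ₙ_) xs ++ pairSums xs)   ≡⟨ length-++ (map (x +ₙ_) xs) ⟩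
  length (map (x +ₙ_) xs) + length (pairSums xs)
    ≡⟨ cong₂ _+_ (trans (length-map (x +ₙ_) xs) (sym (nC1≡n (length xs)))) (length-pairSums xs) ⟩
  length xs C 1 + length xs C 2            ≡⟨ nCk+nC[k+1]≡[n+1]C[k+1] (length xs) 1 ⟩
  suc (length xs) C 2                      ∎
  where open ≡-Reasoning

∈-pairSums⁺ : ∀ {n} {xs : List (Fin n)} {a b} → a ∈ xs → b ∈ xs → a ≢ b → a +ₙ b ∈ pairSums xs
∈-pairSums⁺         (here refl) (here refl) a≢b = contradiction refl a≢b
∈-pairSums⁺ {xs = x ∷ xs} (here refl) (there b∈xs) _ = ∈-++⁺ˡ (∈-map⁺ (x +ₙ_) b∈xs)
∈-pairSums⁺ {xs = x ∷ xs} {a} (there a∈xs) (here refl) _ rewrite +ₙ-comm a x = ∈-++⁺ˡ (∈-map⁺ (x +ₙ_) a∈xs)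
∈-pairSums⁺ {xs = x ∷ xs} (there a∈xs) (there b∈xs) a≢b = ∈-++⁺ʳ (map (x +ₙ_) xs) (∈-pairSums⁺ a∈xs b∈xs a≢b)

∈-pairSums⁻ : ∀ {n} {xs : List (Fin n)} → Unique xs → ∀ {v} → v ∈ pairSums xs →
              ∃₂ λ a b → a ∈ xs × b ∈ xs × a ≢ b × v ≡ a +ₙ b
∈-pairSums⁻ {xs = x ∷ xs} (x∉xs ∷ unique) v∈ with ∈-++⁻ (map (x +ₙ_) xs) v∈
... | inj₁ v∈map with ∈-map⁻ (x +ₙ_) v∈map
...   | b , b∈xs , v≡x+b = x , b , here refl , there b∈xs , All.lookup x∉xs b∈xs , v≡x+b
∈-pairSums⁻ {xs = x ∷ xs} (_ ∷ unique) v∈ | inj₂ v∈sums with ∈-pairSums⁻ unique v∈sums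
...   | a , b , a∈xs , b∈xs , a≢b , v≡a+b = a , b , there a∈xs , there b∈xs , a≢b , v≡a+b

WeakSidon : ∀ {n} → List (Fin n) → Set
WeakSidon xs = ∀ {a b c d} → a ∈ xs → b ∈ xs → c ∈ xs → d ∈ xs →
               Unique (a ∷ b ∷ c ∷ d ∷ []) → a +ₙ b ≢ c +ₙ d

pairSums-unique : ∀ {n} {xs : List (Fin n)} → Unique xs → WeakSidon xs → Unique (pairSums xs)
pairSums-unique {xs = []}     []             _     = []
pairSums-unique {xs = x ∷ xs} (x∉xs ∷ unique) sidon =
  Unique.++⁺ (Unique.map⁺ (+ₙ-cancelˡ x) unique) (pairSums-unique unique sidon-tail) disjoint
  where
  sidon-tail : WeakSidon xs
  sidon-tail a b c d = sidon (there a) (there b) (there c) (there d)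
  x≢ : ∀ {y} → y ∈ xs → x ≢ y
  x≢ = All.lookup x∉xs
  disjoint : ∀ {v} → ¬ (v ∈ map (x +ₙ_) xs × v ∈ pairSums xs)
  disjoint (v∈map , v∈sums) with ∈-map⁻ (x +ₙ_) v∈map | ∈-pairSums⁻ unique v∈sums
  ... | b , b∈xs , refl | c , d , c∈xs , d∈xs , c≢d , x+b≡c+d =
    sidon (here refl) (there b∈xs) (there c∈xs) (there d∈xs) distinct x+b≡c+d
    where
    b≢c : b ≢ c
    b≢c refl = x≢ d∈xs (+ₙ-cancelʳ b (trans x+b≡c+d (+ₙ-comm b d)))
    b≢d : b ≢ d
    b≢d refl = x≢ c∈xs (+ₙ-cancelʳ b x+b≡c+d)
    distinct : Unique (x ∷ b ∷ c ∷ d ∷ [])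
    distinct = (x≢ b∈xs ∷ x≢ c∈xs ∷ x≢ d∈xs ∷ []) ∷ (b≢c ∷ b≢d ∷ []) ∷ (c≢d ∷ []) ∷ [] ∷ []

restrictedSumset≡toSubset-pairSums : ∀ {n} (X : Subset n) →
                                     restrictedSumset X ≡ toSubset (pairSums (elements X))
restrictedSumset≡toSubset-pairSums {n} X = Vec-tabulate-cong (λ z → T-ext (sound z) (complete z))
  where
  open Equivalence
  restricted-sum : Fin n → Fin n → Fin n → Bool
  restricted-sum z x y = lookup X x ∧ lookup X y ∧ not (x =ᶠ y) ∧ ((x +ₙ y) =ᶠ z)
  sound : ∀ z → T (any (λ x → any (restricted-sum z x) (allFin n)) (allFin n)) →
          T (any (_=ᶠ z) (pairSums (elements X)))
  sound z h with any-allFin⁻ _ h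
  ... | x , hx with any-allFin⁻ _ hx
  ... | y , hy with to (T-∧ {lookup X x}) hy
  ... | x∈X , hy′ with to (T-∧ {lookup X y}) hy′
  ... | y∈X , hy″ with to (T-∧ {not (x =ᶠ y)}) hy″
  ... | x≠y , x+y=z = any-=ᶠ⁺ (subst (_∈ pairSums (elements X)) (=ᶠ⇒≡ x+y=z)
                        (∈-pairSums⁺ (∈-elements⁺ X x∈X) (∈-elements⁺ X y∈X) (T-not⇒¬T x≠y ∘ ≡⇒=ᶠ)))
  complete : ∀ z → T (any (_=ᶠ z) (pairSums (elements X))) →
             T (any (λ x → any (restricted-sum z x) (allFin n)) (allFin n))
  complete z h with ∈-pairSums⁻ (elements-unique X) (any-=ᶠ⁻ _ h)
  ... | a , b , a∈ , b∈ , a≢b , refl =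
    any-allFin⁺ _ a (any-allFin⁺ _ b
      (from (T-∧ {lookup X a}) (∈-elements⁻ X a∈ , from (T-∧ {lookup X b})
        (∈-elements⁻ X b∈ , from (T-∧ {not (a =ᶠ b)}) (¬T⇒T-not (a≢b ∘ =ᶠ⇒≡) , ≡⇒=ᶠ {x = a +ₙ b} refl)))))

∣restrictedSumset∣≡C : ∀ {n} (X : Subset n) → WeakSidon (elements X) → ∣ restrictedSumset X ∣ ≡ ∣ X ∣ C 2
∣restrictedSumset∣≡C X sidon = begin
  ∣ restrictedSumset X ∣               ≡⟨ cong ∣_∣ (restrictedSumset≡toSubset-pairSums X) ⟩
  ∣ toSubset (pairSums (elements X)) ∣ ≡⟨ ∣toSubset∣≡length (pairSums-unique (elements-unique X) sidon) ⟩
  length (pairSums (elements X))       ≡⟨ length-pairSums (elements X) ⟩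
  length (elements X) C 2              ≡⟨ cong (_C 2) (length-elements X) ⟩
  ∣ X ∣ C 2                            ∎
  where open ≡-Reasoning

-- Counting subsets

∑-allSubsets-suc : ∀ n (f : Subset (suc n) → ℕ) →
  ∑ (allSubsets (suc n)) f ≡ (∑[ X ∈ allSubsets n ] f (inside ∷ X)) + (∑[ X ∈ allSubsets n ] f (outside ∷ X))
∑-allSubsets-suc n f = trans (∑-++ (map (inside ∷_) (allSubsets n)) _ f)
  (cong₂ _+_ (∑-map (inside ∷_) (allSubsets n) f) (∑-map (outside ∷_) (allSubsets n) f))

#subsets-of-size : ∀ n k → ∑[ X ∈ allSubsets n ] ⟦ ∣ X ∣ ≡ᵇ k ⟧ ≡ n C k
#subsets-of-size zero    zero    = refl
#subsets-of-size zero    (suc k) = refl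
#subsets-of-size (suc n) zero    =
  trans (∑-allSubsets-suc n _) (cong₂ _+_ (∑-0 (allSubsets n)) (#subsets-of-size n zero))
#subsets-of-size (suc n) (suc k) =
  trans (∑-allSubsets-suc n _) (trans (cong₂ _+_ (#subsets-of-size n k) (#subsets-of-size n (suc k)))
                                       (nCk+nC[k+1]≡[n+1]C[k+1] n k))

#supersets-of-size : ∀ {n} → Subset n → ℕ → ℕ
#supersets-of-size {n} S k = ∑[ X ∈ allSubsets n ] ⟦ ∣ X ∣ ≡ᵇ k ⟧ * ⟦ does (S ⊆? X) ⟧

k<∣S∣⇒⟦∣X∣≡ᵇk⟧*⟦S⊆X⟧≡0 : ∀ {n k} (S X : Subset n) → k < ∣ S ∣ → ⟦ ∣ X ∣ ≡ᵇ k ⟧ * ⟦ does (S ⊆? X) ⟧ ≡ 0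
k<∣S∣⇒⟦∣X∣≡ᵇk⟧*⟦S⊆X⟧≡0 S X k<∣S∣ with S ⊆? X
... | no  _   = *-zeroʳ ⟦ ∣ X ∣ ≡ᵇ _ ⟧
... | yes S⊆X = cong (_* 1) (⟦⟧≡0 (λ ∣X∣≡k →
                  <⇒≱ k<∣S∣ (subst (∣ S ∣ ≤_) (≡ᵇ⇒≡ _ _ ∣X∣≡k) (p⊆q⇒∣p∣≤∣q∣ S⊆X))))

#supersets-of-size-< : ∀ {n k} (S : Subset n) → k < ∣ S ∣ → #supersets-of-size S k ≡ 0
#supersets-of-size-< {n} S k<∣S∣ =
  trans (∑-cong (allSubsets n) (λ X → k<∣S∣⇒⟦∣X∣≡ᵇk⟧*⟦S⊆X⟧≡0 S X k<∣S∣)) (∑-0 (allSubsets n))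

#supersets-of-size-≡ : ∀ {n} (S : Subset n) j → #supersets-of-size S (j + ∣ S ∣) ≡ (n ∸ ∣ S ∣) C j
#supersets-of-size-≡ []             zero    = refl
#supersets-of-size-≡ []             (suc j) = refl
#supersets-of-size-≡ {suc n} (inside ∷ S) j =
  trans (∑-allSubsets-suc n _) (trans (cong₂ _+_ containing-0 avoiding-0) (+-identityʳ _))
  where
  containing-0 : ∑[ X ∈ allSubsets n ] ⟦ suc ∣ X ∣ ≡ᵇ j + suc ∣ S ∣ ⟧ * ⟦ does (S ⊆? X) ⟧ ≡ (n ∸ ∣ S ∣) C j
  containing-0 rewrite +-suc j ∣ S ∣ = #supersets-of-size-≡ S j
  avoiding-0 : ∑[ X ∈ allSubsets n ] ⟦ ∣ X ∣ ≡ᵇ j + suc ∣ S ∣ ⟧ * 0 ≡ 0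
  avoiding-0 = trans (∑-cong (allSubsets n) (λ X → *-zeroʳ ⟦ ∣ X ∣ ≡ᵇ j + suc ∣ S ∣ ⟧)) (∑-0 (allSubsets n))
#supersets-of-size-≡ {suc n} (outside ∷ S) zero =
  trans (∑-allSubsets-suc n _) (cong₂ _+_ containing-0 (#supersets-of-size-≡ S zero))
  where
  containing-0 : ∑[ X ∈ allSubsets n ] ⟦ suc ∣ X ∣ ≡ᵇ ∣ S ∣ ⟧ * ⟦ does (S ⊆? X) ⟧ ≡ 0
  containing-0 = trans
    (∑-cong (allSubsets n) (λ X → k<∣S∣⇒⟦∣X∣≡ᵇk⟧*⟦S⊆X⟧≡0 (inside ∷ S) (inside ∷ X) (n<1+n ∣ S ∣)))
    (∑-0 (allSubsets n))
#supersets-of-size-≡ {suc n} (outside ∷ S) (suc j) =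
  trans (∑-allSubsets-suc n _)
    (trans (cong₂ _+_ (#supersets-of-size-≡ S j) (#supersets-of-size-≡ S (suc j)))
      (trans (nCk+nC[k+1]≡[n+1]C[k+1] (n ∸ ∣ S ∣) j) (cong (_C suc j) (sym (+-∸-assoc 1 (∣p∣≤n S))))))

-- Additive quadruples

AdditiveQuadruple : ∀ {n} → Fin n → Fin n → Fin n → Fin n → Set
AdditiveQuadruple a b c d = Unique (a ∷ b ∷ c ∷ d ∷ []) × a +ₙ b ≡ c +ₙ d

additiveQuadruple? : ∀ {n} (a b c d : Fin n) → Dec (AdditiveQuadruple a b c d)
additiveQuadruple? a b c d = UniqueDec.unique? _≟ᶠ_ (a ∷ b ∷ c ∷ d ∷ []) ×-dec (a +ₙ b ≟ᶠ c +ₙ d)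

∣additiveQuadruple∣≡4 : ∀ {n} {a b c d : Fin n} → AdditiveQuadruple a b c d →
                        ∣ toSubset (a ∷ b ∷ c ∷ d ∷ []) ∣ ≡ 4
∣additiveQuadruple∣≡4 (distinct , _) = ∣toSubset∣≡length distinct

#additiveQuadruplesIn : ∀ {n} → Subset n → ℕ
#additiveQuadruplesIn {n} X = ∑⁴ n λ a b c d →
  ⟦ does (additiveQuadruple? a b c d) ⟧ * ⟦ does (toSubset (a ∷ b ∷ c ∷ d ∷ []) ⊆? X) ⟧

#additiveQuadruplesIn≡0⇒WeakSidon : ∀ {n} (X : Subset n) → #additiveQuadruplesIn X ≡ 0 → WeakSidon (elements X)
#additiveQuadruplesIn≡0⇒WeakSidon {n} X none {a} {b} {c} {d} a∈ b∈ c∈ d∈ distinct a+b≡c+d =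
  contradiction (subst (1 ≤_) none counted) λ ()
  where
  S = toSubset (a ∷ b ∷ c ∷ d ∷ [])
  S⊆X : S ⊆ X
  S⊆X = toSubset⊆ (All.lookup members)
    where
    members : All (T ∘ lookup X) (a ∷ b ∷ c ∷ d ∷ [])
    members = ∈-elements⁻ X a∈ ∷ ∈-elements⁻ X b∈ ∷ ∈-elements⁻ X c∈ ∷ ∈-elements⁻ X d∈ ∷ []
  counted : 1 ≤ #additiveQuadruplesIn X
  counted = subst (_≤ #additiveQuadruplesIn X)
    (cong₂ _*_ (⟦does⟧≡1 (additiveQuadruple? a b c d) (distinct , a+b≡c+d)) (⟦does⟧≡1 (S ⊆? X) S⊆X))
    (≤∑⁴ n _ a b c d)

∑⁴-⟦additiveQuadruple⟧*≤ : ∀ n D →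
  ∑⁴ n (λ a b c d → ⟦ does (additiveQuadruple? a b c d) ⟧ * D) ≤ n * (n * (n * D))
∑⁴-⟦additiveQuadruple⟧*≤ n D = begin
  ∑⁴ n (λ a b c d → ⟦ does (additiveQuadruple? a b c d) ⟧ * D)
    ≤⟨ ∑-mono-≤ (allFin n) (λ a → ∑-mono-≤ (allFin n) λ b → ∑-mono-≤ (allFin n) λ c → fourth-determined a b c) ⟩
  ∑[ a < n ] ∑[ b < n ] ∑[ c < n ] D
    ≡⟨ trans (∑-cong (allFin n) λ a → trans (∑-cong (allFin n) λ b → ∑<-const n D) (∑<-const n (n * D)))
             (∑<-const n (n * (n * D))) ⟩
  n * (n * (n * D)) ∎
  where
  open ≤-Reasoning
  fourth-determined : ∀ a b c → ∑[ d < n ] ⟦ does (additiveQuadruple? a b c d) ⟧ * D ≤ D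
  fourth-determined a b c = begin
    ∑[ d < n ] ⟦ does (additiveQuadruple? a b c d) ⟧ * D  ≡⟨ ∑-*ʳ (allFin n) D _ ⟩
    (∑[ d < n ] ⟦ does (additiveQuadruple? a b c d) ⟧) * D ≤⟨ *-monoˡ-≤ D (∑⟦⟧≤1 _ unique) ⟩
    1 * D                                                 ≡⟨ *-identityˡ D ⟩
    D                                                     ∎
    where
    unique : ∀ {d d′} → T (does (additiveQuadruple? a b c d)) → T (does (additiveQuadruple? a b c d′)) → d ≡ d′
    unique q q′ = +ₙ-cancelˡ c (trans (sym (proj₂ (T-does⇒ (additiveQuadruple? a b c _) q)))
                                      (proj₂ (T-does⇒ (additiveQuadruple? a b c _) q′)))

-- The k-subsets outside 𝒵_k

#𝒵ᶜ : ℕ → ℕ → ℕ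
#𝒵ᶜ n k = ∑[ X ∈ allSubsets n ] ⟦ (∣ X ∣ ≡ᵇ k) ∧ not (∣ restrictedSumset X ∣ ≡ᵇ k C 2) ⟧

#𝒵+#𝒵ᶜ≡C : ∀ n k → #𝒵 n k + #𝒵ᶜ n k ≡ n C k
#𝒵+#𝒵ᶜ≡C n k =
  trans (cong (_+ #𝒵ᶜ n k) (length-filterᵇ _ (allSubsets n)))
    (trans (sym (∑-distrib-+ (allSubsets n) _ _))
      (trans (sym (∑-cong (allSubsets n) λ X → ⟦⟧-split (∣ X ∣ ≡ᵇ k) _)) (#subsets-of-size n k)))

C∸#𝒵≡#𝒵ᶜ : ∀ n k → n C k ∸ #𝒵 n k ≡ #𝒵ᶜ n k
C∸#𝒵≡#𝒵ᶜ n k = trans (cong (_∸ #𝒵 n k) (sym (#𝒵+#𝒵ᶜ≡C n k))) (m+n∸m≡n (#𝒵 n k) (#𝒵ᶜ n k))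

#𝒵∸C≡0 : ∀ n k → #𝒵 n k ∸ n C k ≡ 0
#𝒵∸C≡0 n k = m≤n⇒m∸n≡0 (subst (#𝒵 n k ≤_) (#𝒵+#𝒵ᶜ≡C n k) (m≤m+n (#𝒵 n k) (#𝒵ᶜ n k)))

⟦∉𝒵⟧≤⟦∣X∣≡k⟧*#additiveQuadruplesIn : ∀ {n} k (X : Subset n) →
  ⟦ (∣ X ∣ ≡ᵇ k) ∧ not (∣ restrictedSumset X ∣ ≡ᵇ k C 2) ⟧ ≤ ⟦ ∣ X ∣ ≡ᵇ k ⟧ * #additiveQuadruplesIn X
⟦∉𝒵⟧≤⟦∣X∣≡k⟧*#additiveQuadruplesIn k X with ∣ X ∣ ≡ᵇ k in ∣X∣≡k | #additiveQuadruplesIn X in none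
... | false | _     = z≤n
... | true  | suc _ = ≤-trans (⟦⟧≤1 _) (s≤s z≤n)
... | true  | zero  = ≤-reflexive (⟦⟧≡0 (λ h → T-not⇒¬T h (≡⇒≡ᵇ _ _ sumset-size)))
  where
  sumset-size : ∣ restrictedSumset X ∣ ≡ k C 2
  sumset-size = trans (∣restrictedSumset∣≡C X (#additiveQuadruplesIn≡0⇒WeakSidon X none))
                      (cong (_C 2) (≡ᵇ⇒≡ ∣ X ∣ k (Equivalence.from T-≡ ∣X∣≡k)))

#𝒵ᶜ≤ : ∀ n k D →
       (∀ {a b c d : Fin n} → AdditiveQuadruple a b c d →
        #supersets-of-size (toSubset (a ∷ b ∷ c ∷ d ∷ [])) k ≤ D) →
       #𝒵ᶜ n k ≤ n * (n * (n * D))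
#𝒵ᶜ≤ n k D few-supersets = begin
  #𝒵ᶜ n k
    ≤⟨ ∑-mono-≤ (allSubsets n) (⟦∉𝒵⟧≤⟦∣X∣≡k⟧*#additiveQuadruplesIn k) ⟩
  ∑[ X ∈ allSubsets n ] ⟦ ∣ X ∣ ≡ᵇ k ⟧ * #additiveQuadruplesIn X
    ≡⟨ ∑-cong (allSubsets n) (λ X → ∑⁴-*ˡ n ⟦ ∣ X ∣ ≡ᵇ k ⟧ _) ⟨
  ∑[ X ∈ allSubsets n ] ∑⁴ n (λ a b c d → ⟦ ∣ X ∣ ≡ᵇ k ⟧ * (q a b c d * ⟦ does (S a b c d ⊆? X) ⟧))
    ≡⟨ ∑-∑⁴-comm (allSubsets n) n _ ⟩
  ∑⁴ n (λ a b c d → ∑[ X ∈ allSubsets n ] ⟦ ∣ X ∣ ≡ᵇ k ⟧ * (q a b c d * ⟦ does (S a b c d ⊆? X) ⟧))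
    ≡⟨ ∑⁴-cong n (λ a b c d → trans (∑-cong (allSubsets n) λ X → x∙yz≈y∙xz ⟦ ∣ X ∣ ≡ᵇ k ⟧ (q a b c d) _)
                                         (∑-*ˡ (allSubsets n) (q a b c d) _)) ⟩
  ∑⁴ n (λ a b c d → q a b c d * #supersets-of-size (S a b c d) k)
    ≤⟨ ∑⁴-mono-≤ n (λ a b c d → ⟦does⟧*-mono-≤ (additiveQuadruple? a b c d) few-supersets) ⟩
  ∑⁴ n (λ a b c d → q a b c d * D)
    ≤⟨ ∑⁴-⟦additiveQuadruple⟧*≤ n D ⟩
  n * (n * (n * D)) ∎
  where
  open ≤-Reasoning
  q : Fin n → Fin n → Fin n → Fin n → ℕ
  q a b c d = ⟦ does (additiveQuadruple? a b c d) ⟧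
  S : Fin n → Fin n → Fin n → Fin n → Subset n
  S a b c d = toSubset (a ∷ b ∷ c ∷ d ∷ [])

#𝒵ᶜ-small : ∀ n k → k < 4 → #𝒵ᶜ n k ≡ 0
#𝒵ᶜ-small n k k<4 = n≤0⇒n≡0 (≤-trans (#𝒵ᶜ≤ n k 0 no-supersets) (≤-reflexive n*[n*[n*0]]≡0))
  where
  no-supersets : ∀ {a b c d : Fin n} → AdditiveQuadruple a b c d →
                 #supersets-of-size (toSubset (a ∷ b ∷ c ∷ d ∷ [])) k ≤ 0
  no-supersets {a} {b} {c} {d} q = ≤-reflexive
    (#supersets-of-size-< (toSubset (a ∷ b ∷ c ∷ d ∷ [])) (subst (k <_) (sym (∣additiveQuadruple∣≡4 q)) k<4))
  n*[n*[n*0]]≡0 : n * (n * (n * 0)) ≡ 0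
  n*[n*[n*0]]≡0 = trans (cong (λ x → n * (n * x)) (*-zeroʳ n)) (trans (cong (n *_) (*-zeroʳ n)) (*-zeroʳ n))

#𝒵ᶜ-large : ∀ n j → #𝒵ᶜ n (4 + j) ≤ n * (n * (n * ((n ∸ 4) C j)))
#𝒵ᶜ-large n j = #𝒵ᶜ≤ n (4 + j) ((n ∸ 4) C j) supersets
  where
  supersets : ∀ {a b c d : Fin n} → AdditiveQuadruple a b c d →
              #supersets-of-size (toSubset (a ∷ b ∷ c ∷ d ∷ [])) (4 + j) ≤ (n ∸ 4) C j
  supersets {a} {b} {c} {d} q rewrite +-comm 4 j | sym (∣additiveQuadruple∣≡4 q) =
    ≤-reflexive (#supersets-of-size-≡ (toSubset (a ∷ b ∷ c ∷ d ∷ [])) j)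

-- Binomial estimates

[1+k]*[1+n]C[1+k]≡[1+n]*nCk : ∀ n k → suc k * (suc n C suc k) ≡ suc n * (n C k)
[1+k]*[1+n]C[1+k]≡[1+n]*nCk zero    zero    = refl
[1+k]*[1+n]C[1+k]≡[1+n]*nCk zero    (suc k) = *-zeroʳ (suc (suc k))
[1+k]*[1+n]C[1+k]≡[1+n]*nCk (suc n) zero    =
  trans (*-identityˡ _) (trans (nC1≡n (suc (suc n))) (sym (*-identityʳ (suc (suc n)))))
[1+k]*[1+n]C[1+k]≡[1+n]*nCk (suc n) (suc k) = begin
  suc K * (suc N C suc K)                      ≡⟨ cong (suc K *_) (nCk+nC[k+1]≡[n+1]C[k+1] N K) ⟨
  suc K * (N C K + N C suc K)                  ≡⟨ *-distribˡ-+ (suc K) (N C K) (N C suc K) ⟩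
  (N C K + K * (N C K)) + suc K * (N C suc K)
    ≡⟨ cong₂ (λ x y → (N C K + x) + y) ([1+k]*[1+n]C[1+k]≡[1+n]*nCk n k) ([1+k]*[1+n]C[1+k]≡[1+n]*nCk n K) ⟩
  (N C K + N * (n C k)) + N * (n C K)          ≡⟨ +-assoc (N C K) _ _ ⟩
  N C K + (N * (n C k) + N * (n C K))          ≡⟨ cong (N C K +_) (*-distribˡ-+ N (n C k) (n C K)) ⟨
  N C K + N * (n C k + n C K)                  ≡⟨ cong (λ x → N C K + N * x) (nCk+nC[k+1]≡[n+1]C[k+1] n k) ⟩
  N C K + N * (N C K)                          ∎
  where
  open ≡-Reasoning
  N = suc n
  K = suc k

infix 8 _↓_
_↓_ : ℕ → ℕ → ℕ
n ↓ zero  = 1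
n ↓ suc j = n * (pred n ↓ j)

↓-absorption : ∀ j n k → (j + k) ↓ j * ((j + n) C (j + k)) ≡ (j + n) ↓ j * (n C k)
↓-absorption zero    n k = refl
↓-absorption (suc j) n k = begin
  suc (j + k) * x * (suc (j + n) C suc (j + k))    ≡⟨ *-assoc (suc (j + k)) x _ ⟩
  suc (j + k) * (x * (suc (j + n) C suc (j + k)))  ≡⟨ x∙yz≈y∙xz (suc (j + k)) x _ ⟩
  x * (suc (j + k) * (suc (j + n) C suc (j + k)))  ≡⟨ cong (x *_) ([1+k]*[1+n]C[1+k]≡[1+n]*nCk (j + n) (j + k)) ⟩
  x * (suc (j + n) * ((j + n) C (j + k)))          ≡⟨ x∙yz≈y∙xz x (suc (j + n)) _ ⟩
  suc (j + n) * (x * ((j + n) C (j + k)))          ≡⟨ cong (suc (j + n) *_) (↓-absorption j n k) ⟩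
  suc (j + n) * ((j + n) ↓ j * (n C k))            ≡⟨ *-assoc (suc (j + n)) ((j + n) ↓ j) (n C k) ⟨
  suc (j + n) * (j + n) ↓ j * (n C k)              ∎
  where
  open ≡-Reasoning
  x = (j + k) ↓ j

↓≤^ : ∀ n j → n ↓ j ≤ n ^ j
↓≤^ n zero    = ≤-refl
↓≤^ n (suc j) = *-monoʳ-≤ n (≤-trans (↓≤^ (pred n) j) (^-monoˡ-≤ j pred[n]≤n))

-- As a polynomial in t, 8·(6 + t)↓4 − (6 + t)⁴ has nonnegative coefficients.
[6+t]^4≤8*[6+t]↓4 : ∀ t → (6 + t) ^ 4 ≤ 8 * ((6 + t) ↓ 4)
[6+t]^4≤8*[6+t]↓4 t = subst ((6 + t) ^ 4 ≤_) (sym expansion) (m≤m+n _ _)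
  where
  open +-*-Solver
  expansion : 8 * ((6 + t) ↓ 4) ≡ (6 + t) ^ 4 + (7 * t ^ 4 + 120 * t ^ 3 + 736 * t ^ 2 + 1872 * t + 1584)
  expansion = solve 1 (λ t →
      con 8 :* ((con 6 :+ t) :* ((con 5 :+ t) :* ((con 4 :+ t) :* ((con 3 :+ t) :* con 1))))
    := (con 6 :+ t) :^ 4 :+ (con 7 :* t :^ 4 :+ con 120 :* t :^ 3 :+ con 736 :* t :^ 2 :+ con 1872 :* t :+ con 1584))
    refl t

p*n^3≤n↓4 : ∀ p t → 8 * p ≤ 6 + t → p * (6 + t) ^ 3 ≤ (6 + t) ↓ 4
p*n^3≤n↓4 p t 8p≤n = *-cancelˡ-≤ 8 (begin
  8 * (p * n ^ 3)  ≡⟨ *-assoc 8 p (n ^ 3) ⟨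
  8 * p * n ^ 3    ≤⟨ *-monoˡ-≤ (n ^ 3) 8p≤n ⟩
  n ^ 4            ≤⟨ [6+t]^4≤8*[6+t]↓4 t ⟩
  8 * n ↓ 4        ∎)
  where
  open ≤-Reasoning
  n = 6 + t

[1+m]*n^3*[n∸4]Cj≤nC[4+j] : ∀ m t j → 8 * (suc m * (4 + j) ^ 4) ≤ 6 + t →
                         suc m * ((6 + t) * ((6 + t) * ((6 + t) * ((2 + t) C j)))) ≤ (6 + t) C (4 + j)
[1+m]*n^3*[n∸4]Cj≤nC[4+j] m t j small = *-cancelˡ-≤ ((4 + j) ↓ 4) (begin
  (4 + j) ↓ 4 * (suc m * (n * (n * (n * c))))  ≤⟨ *-monoˡ-≤ _ (↓≤^ (4 + j) 4) ⟩
  (4 + j) ^ 4 * (suc m * (n * (n * (n * c))))  ≡⟨ rearrange ((4 + j) ^ 4) (suc m) n c ⟩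
  suc m * (4 + j) ^ 4 * n ^ 3 * c              ≤⟨ *-monoˡ-≤ c (p*n^3≤n↓4 (suc m * (4 + j) ^ 4) t small) ⟩
  n ↓ 4 * c                                    ≡⟨ ↓-absorption 4 (2 + t) j ⟨
  (4 + j) ↓ 4 * (n C (4 + j))                  ∎)
  where
  open ≤-Reasoning
  open +-*-Solver
  n = 6 + t
  c = (2 + t) C j
  rearrange : ∀ a b n c → a * (b * (n * (n * (n * c)))) ≡ b * a * n ^ 3 * c
  rearrange = solve 4 (λ a b n c → a :* (b :* (n :* (n :* (n :* c)))) := b :* a :* n :^ 3 :* c) refl

[1+m]*#𝒵ᶜ≤C : ∀ m n k → 8 * (suc m * k ^ 4) ≤ n → 6 ≤ n → suc m * #𝒵ᶜ n k ≤ n C k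
[1+m]*#𝒵ᶜ≤C m n 0 _ _ rewrite #𝒵ᶜ-small n 0 (s≤s z≤n) | *-zeroʳ m = z≤n
[1+m]*#𝒵ᶜ≤C m n 1 _ _ rewrite #𝒵ᶜ-small n 1 (s≤s (s≤s z≤n)) | *-zeroʳ m = z≤n
[1+m]*#𝒵ᶜ≤C m n 2 _ _ rewrite #𝒵ᶜ-small n 2 (s≤s (s≤s (s≤s z≤n))) | *-zeroʳ m = z≤n
[1+m]*#𝒵ᶜ≤C m n 3 _ _ rewrite #𝒵ᶜ-small n 3 (s≤s (s≤s (s≤s (s≤s z≤n)))) | *-zeroʳ m = z≤n
[1+m]*#𝒵ᶜ≤C m _ (suc (suc (suc (suc j)))) small (s≤s (s≤s (s≤s (s≤s (s≤s (s≤s (z≤n {t}))))))) =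
  ≤-trans (*-monoʳ-≤ (suc m) (#𝒵ᶜ-large (6 + t) j)) ([1+m]*n^3*[n∸4]Cj≤nC[4+j] m t j small)

lemma9p2 : (k : ℕ → ℕ)
         → (∀ m → ∃[ N ] ∀ n → N ≤ n → suc m * k n ^ 4 ≤ n)
         → ∀ m → ∃[ N ] ∀ n → N ≤ n → Prime n
         → (suc m * ((n C k n) ∸ #𝒵 n (k n)) ≤ n C k n)
           × (suc m * (#𝒵 n (k n) ∸ (n C k n)) ≤ n C k n)
lemma9p2 k k⁴=o[n] m with k⁴=o[n] (7 + 8 * m)
... | N , k⁴-small = N + 6 , λ n N+6≤n _ →
    subst (λ x → suc m * x ≤ n C k n) (sym (C∸#𝒵≡#𝒵ᶜ n (k n)))
      ([1+m]*#𝒵ᶜ≤C m n (k n) (8[1+m]k⁴≤n n (≤-trans (m≤m+n N 6) N+6≤n)) (≤-trans (m≤n+m 6 N) N+6≤n))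
  , subst (λ x → suc m * x ≤ n C k n) (sym (#𝒵∸C≡0 n (k n))) (≤-trans (≤-reflexive (*-zeroʳ (suc m))) z≤n)
  where
  8[1+m]k⁴≤n : ∀ n → N ≤ n → 8 * (suc m * k n ^ 4) ≤ n
  8[1+m]k⁴≤n n N≤n = subst (_≤ n) (8+8m≡8[1+m] m (k n ^ 4)) (k⁴-small n N≤n)
    where
    open +-*-Solver
    8+8m≡8[1+m] : ∀ m x → suc (7 + 8 * m) * x ≡ 8 * (suc m * x)
    8+8m≡8[1+m] = solve 2 (λ m x → (con 8 :+ con 8 :* m) :* x := con 8 :* ((con 1 :+ m) :* x)) refl
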